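{- For every integer $n\ge0$, \[ \begin{aligned} \left(H_{n+2}^{(3)}\right)^{2}+s\left(H_{n+1}^{(3)}\right)^{2}+2tH_{n}^{(3)}H_{n+1}^{(3)} &=(c^{2}+sb^{2}+2tab)h_{2n+1}^{(3)}+\big(b^{2}(t-rs)+2tac+2sbc-2rtab\big)h_{2n}^{(3)}\\ &\quad+t(ta^{2}-rb^{2}+2bc)h_{2n-1}^{(3)}\\ &=cH_{2n+2}^{(3)}+(sb+ta)H_{2n+1}^{(3)}+tbH_{2n}^{(3)}. \end{aligned} \]
   Context: Let $r,s,t,a,b,c$ be real numbers with $t\neq0$ (the paper also assumes throughout that $\Delta=\frac{r^{3}t}{27}-\frac{r^{2}s^{2}}{108}+\frac{rst}{6}-\frac{s^{3}}{27}+\frac{t^{2}}{4}>0$). The third-order Horadam numbers are defined by $H_0^{(3)}=a$, $H_1^{(3)}=b$, $H_2^{(3)}=c$, $H_{n+3}^{(3)}=rH_{n+2}^{(3)}+sH_{n+1}^{(3)}+tH_n^{(3)}$ ($n\ge0$). The generalized Tribonacci numbers are defined by $h_0^{(3)}=0$, $h_1^{(3)}=1$, $h_2^{(3)}=r$, $h_{n+3}^{(3)}=rh_{n+2}^{(3)}+sh_{n+1}^{(3)}+th_n^{(3)}$ ($n\ge0$); for $n=0$ the term $h_{ -1}^{(3)}$ is given by the backward recurrence, i.e. $h_{ -1}^{(3)}=0$. -}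

module Defs where

open import Level using (Level)
open import Data.Nat using (ℕ; zero; suc)
open import Algebra.Bundles using (CommutativeRing)

-- Third-order Horadam numbers and generalized Tribonacci numbers over an
-- arbitrary commutative ring R (the paper works over the reals).
module Seqs {c ℓ : Level} (R : CommutativeRing c ℓ) where
  open CommutativeRing R

  two : Carrier
  two = 1# + 1#

  H : (r s t a b c' : Carrier) → ℕ → Carrier
  H r s t a b c' zero = a
  H r s t a b c' (suc zero) = b
  H r s t a b c' (suc (suc zero)) = c'
  H r s t a b c' (suc (suc (suc n))) =
    r * H r s t a b c' (suc (suc n)) + s * H r s t a b c' (suc n) + t * H r s t a b c' n

  h : (r s t : Carrier) → ℕ → Carrier
  h r s t = H r s t 0# 1# r

  -- hOdd n = h_{2n-1}^(3), with h_{-1}^(3) = 0 (backward recurrence)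
  hOdd : (r s t : Carrier) → ℕ → Carrier
  hOdd r s t zero = 0#
  hOdd r s t (suc m) = h r s t (suc (m Data.Nat.+ m))

-- On solutions X, Y of the recurrence the bilinear form
--   pairing X Y i j = X_{i+2} Y_{j+2} + s X_{i+1} Y_{j+1} + t (X_i Y_{j+1} + X_{i+1} Y_j)
-- does not change when a shift is moved from Y to X, so pairing H H n n equals pairing H H 2n 0;
-- these are the first and the last expression. The middle one appears after writing
-- H_m = a h_{m+1} + (b − r a) h_m + (c − r b − s a) h_{m−1}, which holds because both
-- sides solve the recurrence with the same initial values.
module Submission where

open import Defs
open import Level using (Level; 0ℓ)
open import Data.Nat using (ℕ)
open import Data.Product using (_×_)
open import Relation.Nullary using (¬_)
open import Algebra.Bundles using (CommutativeRing)

open import Data.Nat as ℕ using (zero; suc)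
import Data.Nat.Properties as ℕ
open import Data.Product using (_,_; proj₁)
open import Data.Maybe using (Maybe; just; nothing)
open import Relation.Nullary using (yes; no)
import Relation.Binary.PropositionalEquality as ≡
open import Algebra.Bundles using (RawRing)
open import Algebra.Solver.Ring.AlmostCommutativeRing
  using (fromCommutativeRing; _-Raw-AlmostCommutative⟶_)

-- Integer coefficients, the pair (p , q) standing for p − q.
module IntegerCoefficientSolver {c ℓ : Level} (R : CommutativeRing c ℓ) where
  open CommutativeRing R
  open import Algebra.Properties.Semiring.Mult.TCOptimised semiring
    using (×-homo-+; ×1-homo-*) renaming (_×_ to _×′_)
  open import Algebra.Properties.Ring ring using ([y-z]x≈yx-zx; x[y-z]≈xy-xz)
  open import Algebra.Properties.Group +-group using (ε⁻¹≈ε)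
  open import Algebra.Properties.AbelianGroup +-abelianGroup using (⁻¹-∙-comm; ⁻¹-anti-homo‿-)
  open import Algebra.Properties.CommutativeSemigroup +-commutativeSemigroup using (interchange)
  open import Relation.Binary.Reasoning.Setoid setoid

  -‿distrib-+ : ∀ x y → - (x + y) ≈ - x + - y
  -‿distrib-+ x y = sym (⁻¹-∙-comm x y)

  x-0≈x : ∀ x → x - 0# ≈ x
  x-0≈x x = trans (+-congˡ ε⁻¹≈ε) (+-identityʳ x)

  [x+y]-[z+w]≈[x-z]+[y-w] : ∀ x y z w → (x + y) - (z + w) ≈ (x - z) + (y - w)
  [x+y]-[z+w]≈[x-z]+[y-w] x y z w =
    trans (+-congˡ (-‿distrib-+ z w)) (interchange x y (- z) (- w))

  [x-y]-[z-w]≈[x+w]-[z+y] : ∀ x y z w → (x - y) - (z - w) ≈ (x + w) - (z + y)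
  [x-y]-[z-w]≈[x+w]-[z+y] x y z w = begin
    (x - y) - (z - w)     ≈⟨ +-congˡ (⁻¹-anti-homo‿- z w) ⟩
    (x - y) + (w - z)     ≈⟨ interchange x (- y) w (- z) ⟩
    (x + w) + (- y - z)   ≈⟨ +-congˡ (+-comm (- y) (- z)) ⟩
    (x + w) + (- z - y)   ≈⟨ +-congˡ (-‿distrib-+ z y) ⟨
    (x + w) - (z + y)     ∎

  [x+z]-[y+z]≈x-y : ∀ x y z → (x + z) - (y + z) ≈ x - y
  [x+z]-[y+z]≈x-y x y z = begin
    (x + z) - (y + z)  ≈⟨ [x+y]-[z+w]≈[x-z]+[y-w] x z y z ⟩
    (x - y) + (z - z)  ≈⟨ +-congˡ (-‿inverseʳ z) ⟩
    (x - y) + 0#       ≈⟨ +-identityʳ (x - y) ⟩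
    x - y              ∎

  x+w≈z+y⇒x-y≈z-w : ∀ {x y z w} → x + w ≈ z + y → x - y ≈ z - w
  x+w≈z+y⇒x-y≈z-w {x} {y} {z} {w} eq = begin
    x - y              ≈⟨ [x+z]-[y+z]≈x-y x y w ⟨
    (x + w) - (y + w)  ≈⟨ +-cong eq (-‿cong (+-comm y w)) ⟩
    (z + y) - (w + y)  ≈⟨ [x+z]-[y+z]≈x-y z w y ⟩
    z - w              ∎

  ℕ²-rawRing : RawRing 0ℓ 0ℓ
  ℕ²-rawRing = record
    { Carrier = ℕ × ℕ
    ; _≈_ = ≡._≡_
    ; _+_ = λ { (p , q) (p′ , q′) → (p ℕ.+ p′ , q ℕ.+ q′) }
    ; _*_ = λ { (p , q) (p′ , q′) → (p ℕ.* p′ ℕ.+ q ℕ.* q′ , p ℕ.* q′ ℕ.+ q ℕ.* p′) }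
    ; -_ = λ { (p , q) → (q , p) }
    ; 0# = (0 , 0)
    ; 1# = (1 , 0)
    }

  -- The case split makes ⟦ (n , 0) ⟧ reduce to n ×′ 1#, so that con (2 , 0)
  -- is definitionally 1# + 1#.
  ⟦_⟧ : ℕ × ℕ → Carrier
  ⟦ p , zero ⟧ = p ×′ 1#
  ⟦ p , suc q ⟧ = p ×′ 1# - suc q ×′ 1#

  ⟦p,q⟧≈p-q : ∀ p q → ⟦ p , q ⟧ ≈ p ×′ 1# - q ×′ 1#
  ⟦p,q⟧≈p-q p zero = sym (x-0≈x (p ×′ 1#))
  ⟦p,q⟧≈p-q p (suc q) = refl

  +-homo : ∀ x y → ⟦ RawRing._+_ ℕ²-rawRing x y ⟧ ≈ ⟦ x ⟧ + ⟦ y ⟧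
  +-homo (p , q) (p′ , q′) = begin
    ⟦ p ℕ.+ p′ , q ℕ.+ q′ ⟧                     ≈⟨ ⟦p,q⟧≈p-q (p ℕ.+ p′) (q ℕ.+ q′) ⟩
    (p ℕ.+ p′) ×′ 1# - (q ℕ.+ q′) ×′ 1#          ≈⟨ +-cong (×-homo-+ 1# p p′) (-‿cong (×-homo-+ 1# q q′)) ⟩
    (P + P′) - (Q + Q′)                          ≈⟨ [x+y]-[z+w]≈[x-z]+[y-w] P P′ Q Q′ ⟩
    (P - Q) + (P′ - Q′)                          ≈⟨ +-cong (⟦p,q⟧≈p-q p q) (⟦p,q⟧≈p-q p′ q′) ⟨
    ⟦ p , q ⟧ + ⟦ p′ , q′ ⟧                       ∎
    where
    P P′ Q Q′ : Carrier
    P = p ×′ 1#; P′ = p′ ×′ 1#; Q = q ×′ 1#; Q′ = q′ ×′ 1#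

  *-homo : ∀ x y → ⟦ RawRing._*_ ℕ²-rawRing x y ⟧ ≈ ⟦ x ⟧ * ⟦ y ⟧
  *-homo (p , q) (p′ , q′) = begin
    ⟦ p ℕ.* p′ ℕ.+ q ℕ.* q′ , p ℕ.* q′ ℕ.+ q ℕ.* p′ ⟧
      ≈⟨ ⟦p,q⟧≈p-q (p ℕ.* p′ ℕ.+ q ℕ.* q′) (p ℕ.* q′ ℕ.+ q ℕ.* p′) ⟩
    (p ℕ.* p′ ℕ.+ q ℕ.* q′) ×′ 1# - (p ℕ.* q′ ℕ.+ q ℕ.* p′) ×′ 1#
      ≈⟨ +-cong (embed-sum p p′ q q′) (-‿cong (embed-sum p q′ q p′)) ⟩
    (P * P′ + Q * Q′) - (P * Q′ + Q * P′)
      ≈⟨ [x-y]-[z-w]≈[x+w]-[z+y] (P * P′) (Q * P′) (P * Q′) (Q * Q′) ⟨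
    (P * P′ - Q * P′) - (P * Q′ - Q * Q′)
      ≈⟨ +-cong ([y-z]x≈yx-zx P′ P Q) (-‿cong ([y-z]x≈yx-zx Q′ P Q)) ⟨
    (P - Q) * P′ - (P - Q) * Q′
      ≈⟨ x[y-z]≈xy-xz (P - Q) P′ Q′ ⟨
    (P - Q) * (P′ - Q′)
      ≈⟨ *-cong (⟦p,q⟧≈p-q p q) (⟦p,q⟧≈p-q p′ q′) ⟨
    ⟦ p , q ⟧ * ⟦ p′ , q′ ⟧ ∎
    where
    P P′ Q Q′ : Carrier
    P = p ×′ 1#; P′ = p′ ×′ 1#; Q = q ×′ 1#; Q′ = q′ ×′ 1#
    embed-sum : ∀ k l m n → (k ℕ.* l ℕ.+ m ℕ.* n) ×′ 1# ≈ (k ×′ 1#) * (l ×′ 1#) + (m ×′ 1#) * (n ×′ 1#)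
    embed-sum k l m n = trans (×-homo-+ 1# (k ℕ.* l) (m ℕ.* n)) (+-cong (×1-homo-* k l) (×1-homo-* m n))

  -‿homo : ∀ x → ⟦ RawRing.-_ ℕ²-rawRing x ⟧ ≈ - ⟦ x ⟧
  -‿homo (p , q) = begin
    ⟦ q , p ⟧                ≈⟨ ⟦p,q⟧≈p-q q p ⟩
    q ×′ 1# - p ×′ 1#        ≈⟨ ⁻¹-anti-homo‿- (p ×′ 1#) (q ×′ 1#) ⟨
    - (p ×′ 1# - q ×′ 1#)    ≈⟨ -‿cong (⟦p,q⟧≈p-q p q) ⟨
    - ⟦ p , q ⟧              ∎

  homomorphism : ℕ²-rawRing -Raw-AlmostCommutative⟶ fromCommutativeRing R
  homomorphism = record
    { ⟦_⟧ = ⟦_⟧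
    ; +-homo = +-homo
    ; *-homo = *-homo
    ; -‿homo = -‿homo
    ; 0-homo = refl
    ; 1-homo = refl
    }

  ≈-weaklyDecidable : ∀ x y → Maybe (⟦ x ⟧ ≈ ⟦ y ⟧)
  ≈-weaklyDecidable (p , q) (p′ , q′) with p ℕ.+ q′ ℕ.≟ p′ ℕ.+ q
  ... | no _ = nothing
  ... | yes eq = just (begin
    ⟦ p , q ⟧                  ≈⟨ ⟦p,q⟧≈p-q p q ⟩
    p ×′ 1# - q ×′ 1#          ≈⟨ x+w≈z+y⇒x-y≈z-w (begin
        p ×′ 1# + q′ ×′ 1#       ≈⟨ ×-homo-+ 1# p q′ ⟨
        (p ℕ.+ q′) ×′ 1#         ≡⟨ ≡.cong (_×′ 1#) eq ⟩
        (p′ ℕ.+ q) ×′ 1#         ≈⟨ ×-homo-+ 1# p′ q ⟩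
        p′ ×′ 1# + q ×′ 1#       ∎) ⟩
    p′ ×′ 1# - q′ ×′ 1#        ≈⟨ ⟦p,q⟧≈p-q p′ q′ ⟨
    ⟦ p′ , q′ ⟧                ∎)

  open import Algebra.Solver.Ring ℕ²-rawRing (fromCommutativeRing R) homomorphism ≈-weaklyDecidable
    using (solve; _:=_; _:+_; _:*_; _:-_; con) public

module ThirdOrderRecurrence {c ℓ : Level} (R : CommutativeRing c ℓ) (r s t : CommutativeRing.Carrier R) where
  open CommutativeRing R
  open Seqs R
  open IntegerCoefficientSolver R using (solve; _:=_; _:+_; _:*_; _:-_; con)
  open import Relation.Binary.Reasoning.Setoid setoid

  SatisfiesRecurrence : (ℕ → Carrier) → Set ℓ
  SatisfiesRecurrence X = ∀ k → X (3 ℕ.+ k) ≈ r * X (2 ℕ.+ k) + s * X (1 ℕ.+ k) + t * X k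

  H-satisfiesRecurrence : ∀ a b c′ → SatisfiesRecurrence (H r s t a b c′)
  H-satisfiesRecurrence a b c′ k = refl

  recurrence-twice : ∀ {X} → SatisfiesRecurrence X → ∀ k →
    X (4 ℕ.+ k) ≈ r * (r * X (2 ℕ.+ k) + s * X (1 ℕ.+ k) + t * X k) + s * X (2 ℕ.+ k) + t * X (1 ℕ.+ k)
  recurrence-twice rec k = trans (rec (1 ℕ.+ k)) (+-congʳ (+-congʳ (*-congˡ (rec k))))

  recurrence-unique : ∀ {X Y} → SatisfiesRecurrence X → SatisfiesRecurrence Y →
    X 0 ≈ Y 0 → X 1 ≈ Y 1 → X 2 ≈ Y 2 → ∀ m → X m ≈ Y m
  recurrence-unique {X} {Y} recX recY e₀ e₁ e₂ m = proj₁ (agree m)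
    where
    agree : ∀ m → X m ≈ Y m × X (1 ℕ.+ m) ≈ Y (1 ℕ.+ m) × X (2 ℕ.+ m) ≈ Y (2 ℕ.+ m)
    agree zero = e₀ , e₁ , e₂
    agree (suc m) with agree m
    ... | eq₀ , eq₁ , eq₂ = eq₁ , eq₂ , (begin
      X (3 ℕ.+ m)                                  ≈⟨ recX m ⟩
      r * X (2 ℕ.+ m) + s * X (1 ℕ.+ m) + t * X m  ≈⟨ +-cong (+-cong (*-congˡ eq₂) (*-congˡ eq₁)) (*-congˡ eq₀) ⟩
      r * Y (2 ℕ.+ m) + s * Y (1 ℕ.+ m) + t * Y m  ≈⟨ recY m ⟨
      Y (3 ℕ.+ m)                                  ∎)

  shiftCombination : (α β γ : Carrier) → (ℕ → Carrier) → ℕ → Carrier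
  shiftCombination α β γ X m = α * X (2 ℕ.+ m) + β * X (1 ℕ.+ m) + γ * X m

  shiftCombination-satisfiesRecurrence : ∀ α β γ {X} → SatisfiesRecurrence X →
    SatisfiesRecurrence (shiftCombination α β γ X)
  shiftCombination-satisfiesRecurrence α β γ {X} rec k = begin
    α * X (5 ℕ.+ k) + β * X (4 ℕ.+ k) + γ * X (3 ℕ.+ k)
      ≈⟨ +-cong (+-cong (*-congˡ (rec (2 ℕ.+ k))) (*-congˡ (rec (1 ℕ.+ k)))) (*-congˡ (rec k)) ⟩
    α * (r * x₄ + s * x₃ + t * x₂) + β * (r * x₃ + s * x₂ + t * x₁) + γ * (r * x₂ + s * x₁ + t * x₀)
      ≈⟨ solve 11 (λ α β γ r s t x₀ x₁ x₂ x₃ x₄ →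
           α :* (r :* x₄ :+ s :* x₃ :+ t :* x₂) :+ β :* (r :* x₃ :+ s :* x₂ :+ t :* x₁)
             :+ γ :* (r :* x₂ :+ s :* x₁ :+ t :* x₀)
           := r :* (α :* x₄ :+ β :* x₃ :+ γ :* x₂) :+ s :* (α :* x₃ :+ β :* x₂ :+ γ :* x₁)
             :+ t :* (α :* x₂ :+ β :* x₁ :+ γ :* x₀))
           refl α β γ r s t x₀ x₁ x₂ x₃ x₄ ⟩
    r * shiftCombination α β γ X (2 ℕ.+ k) + s * shiftCombination α β γ X (1 ℕ.+ k)
      + t * shiftCombination α β γ X k ∎
    where
    x₀ x₁ x₂ x₃ x₄ : Carrier
    x₀ = X k; x₁ = X (1 ℕ.+ k); x₂ = X (2 ℕ.+ k); x₃ = X (3 ℕ.+ k); x₄ = X (4 ℕ.+ k)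

  hPrev : ℕ → Carrier
  hPrev zero = 0#
  hPrev (suc m) = h r s t m

  hPrev-satisfiesRecurrence : SatisfiesRecurrence hPrev
  hPrev-satisfiesRecurrence zero =
    solve 3 (λ r s t → r := r :* con (1 , 0) :+ s :* con (0 , 0) :+ t :* con (0 , 0)) refl r s t
  hPrev-satisfiesRecurrence (suc k) = refl

  hOdd≈hPrev : ∀ n → hOdd r s t n ≈ hPrev (n ℕ.+ n)
  hOdd≈hPrev zero = refl
  hOdd≈hPrev (suc n) = reflexive (≡.cong (h r s t) (≡.sym (ℕ.+-suc n n)))

  H≈shiftCombination-hPrev : ∀ a b c′ m →
    H r s t a b c′ m ≈ shiftCombination a (b - r * a) (c′ - r * b - s * a) hPrev m
  H≈shiftCombination-hPrev a b c′ =
    recurrence-unique (H-satisfiesRecurrence a b c′)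
      (shiftCombination-satisfiesRecurrence a (b - r * a) (c′ - r * b - s * a) hPrev-satisfiesRecurrence)
      (solve 5 (λ r s a b c′ →
         a := a :* con (1 , 0) :+ (b :- r :* a) :* con (0 , 0) :+ (c′ :- r :* b :- s :* a) :* con (0 , 0))
         refl r s a b c′)
      (solve 5 (λ r s a b c′ →
         b := a :* r :+ (b :- r :* a) :* con (1 , 0) :+ (c′ :- r :* b :- s :* a) :* con (0 , 0))
         refl r s a b c′)
      (solve 6 (λ r s t a b c′ →
         c′ := a :* (r :* r :+ s :* con (1 , 0) :+ t :* con (0 , 0)) :+ (b :- r :* a) :* r
                 :+ (c′ :- r :* b :- s :* a) :* con (1 , 0))
         refl r s t a b c′)

  pairing : (ℕ → Carrier) → (ℕ → Carrier) → ℕ → ℕ → Carrier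
  pairing X Y i j = X (2 ℕ.+ i) * Y (2 ℕ.+ j) + s * (X (1 ℕ.+ i) * Y (1 ℕ.+ j))
                    + t * (X i * Y (1 ℕ.+ j)) + t * (X (1 ℕ.+ i) * Y j)

  pairing-shift : ∀ {X Y} → SatisfiesRecurrence X → SatisfiesRecurrence Y →
    ∀ i j → pairing X Y i (1 ℕ.+ j) ≈ pairing X Y (1 ℕ.+ i) j
  pairing-shift {X} {Y} recX recY i j = begin
    pairing X Y i (1 ℕ.+ j)
      ≈⟨ +-congʳ (+-congʳ (+-congʳ (*-congˡ (recY j)))) ⟩
    x₂ * (r * y₂ + s * y₁ + t * y₀) + s * (x₁ * y₂) + t * (x₀ * y₂) + t * (x₁ * y₁)
      ≈⟨ solve 9 (λ r s t x₀ x₁ x₂ y₀ y₁ y₂ →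
           x₂ :* (r :* y₂ :+ s :* y₁ :+ t :* y₀) :+ s :* (x₁ :* y₂) :+ t :* (x₀ :* y₂) :+ t :* (x₁ :* y₁)
           := (r :* x₂ :+ s :* x₁ :+ t :* x₀) :* y₂ :+ s :* (x₂ :* y₁) :+ t :* (x₁ :* y₁) :+ t :* (x₂ :* y₀))
           refl r s t x₀ x₁ x₂ y₀ y₁ y₂ ⟩
    (r * x₂ + s * x₁ + t * x₀) * y₂ + s * (x₂ * y₁) + t * (x₁ * y₁) + t * (x₂ * y₀)
      ≈⟨ +-congʳ (+-congʳ (+-congʳ (*-congʳ (recX i)))) ⟨
    pairing X Y (1 ℕ.+ i) j ∎
    where
    x₀ x₁ x₂ y₀ y₁ y₂ : Carrier
    x₀ = X i; x₁ = X (1 ℕ.+ i); x₂ = X (2 ℕ.+ i)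
    y₀ = Y j; y₁ = Y (1 ℕ.+ j); y₂ = Y (2 ℕ.+ j)

  pairing-transfer : ∀ {X Y} → SatisfiesRecurrence X → SatisfiesRecurrence Y →
    ∀ k i j → pairing X Y i (k ℕ.+ j) ≈ pairing X Y (k ℕ.+ i) j
  pairing-transfer recX recY zero i j = refl
  pairing-transfer {X} {Y} recX recY (suc k) i j = begin
    pairing X Y i (suc k ℕ.+ j)  ≈⟨ pairing-shift recX recY i (k ℕ.+ j) ⟩
    pairing X Y (suc i) (k ℕ.+ j) ≈⟨ pairing-transfer recX recY k (suc i) j ⟩
    pairing X Y (k ℕ.+ suc i) j  ≡⟨ ≡.cong (λ m → pairing X Y m j) (ℕ.+-suc k i) ⟩
    pairing X Y (suc k ℕ.+ i) j  ∎

  squares≈doubledIndex : ∀ {X} → SatisfiesRecurrence X → ∀ n →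
    X (2 ℕ.+ n) * X (2 ℕ.+ n) + s * (X (1 ℕ.+ n) * X (1 ℕ.+ n)) + two * t * X n * X (1 ℕ.+ n)
    ≈ X 2 * X (2 ℕ.+ (n ℕ.+ n)) + (s * X 1 + t * X 0) * X (1 ℕ.+ (n ℕ.+ n)) + t * X 1 * X (n ℕ.+ n)
  squares≈doubledIndex {X} rec n = begin
    X (2 ℕ.+ n) * X (2 ℕ.+ n) + s * (X (1 ℕ.+ n) * X (1 ℕ.+ n)) + two * t * X n * X (1 ℕ.+ n)
      ≈⟨ solve 5 (λ s t x₀ x₁ x₂ →
           x₂ :* x₂ :+ s :* (x₁ :* x₁) :+ con (2 , 0) :* t :* x₀ :* x₁
           := x₂ :* x₂ :+ s :* (x₁ :* x₁) :+ t :* (x₀ :* x₁) :+ t :* (x₁ :* x₀))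
           refl s t (X n) (X (1 ℕ.+ n)) (X (2 ℕ.+ n)) ⟩
    pairing X X n n             ≡⟨ ≡.cong (pairing X X n) (ℕ.+-identityʳ n) ⟨
    pairing X X n (n ℕ.+ 0)     ≈⟨ pairing-transfer rec rec n n 0 ⟩
    pairing X X (n ℕ.+ n) 0
      ≈⟨ solve 8 (λ s t x₀ x₁ x₂ y₀ y₁ y₂ →
           y₂ :* x₂ :+ s :* (y₁ :* x₁) :+ t :* (y₀ :* x₁) :+ t :* (y₁ :* x₀)
           := x₂ :* y₂ :+ (s :* x₁ :+ t :* x₀) :* y₁ :+ t :* x₁ :* y₀)
           refl s t (X 0) (X 1) (X 2) (X (n ℕ.+ n)) (X (1 ℕ.+ (n ℕ.+ n))) (X (2 ℕ.+ (n ℕ.+ n))) ⟩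
    X 2 * X (2 ℕ.+ (n ℕ.+ n)) + (s * X 1 + t * X 0) * X (1 ℕ.+ (n ℕ.+ n)) + t * X 1 * X (n ℕ.+ n) ∎

  doubledIndex≈hPrev-expansion : ∀ a b c′ k → let X = H r s t a b c′ in
    c′ * X (2 ℕ.+ k) + (s * b + t * a) * X (1 ℕ.+ k) + t * b * X k
    ≈ (c′ * c′ + s * (b * b) + two * t * a * b) * hPrev (2 ℕ.+ k)
      + (b * b * (t - r * s) + two * t * a * c′ + two * s * b * c′ - two * r * t * a * b) * hPrev (1 ℕ.+ k)
      + t * (t * (a * a) - r * (b * b) + two * b * c′) * hPrev k
  doubledIndex≈hPrev-expansion a b c′ k = begin
    c′ * X (2 ℕ.+ k) + (s * b + t * a) * X (1 ℕ.+ k) + t * b * X k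
      ≈⟨ +-cong (+-cong (*-congˡ (H≈shiftCombination-hPrev a b c′ (2 ℕ.+ k)))
                        (*-congˡ (H≈shiftCombination-hPrev a b c′ (1 ℕ.+ k))))
                (*-congˡ (H≈shiftCombination-hPrev a b c′ k)) ⟩
    c′ * (a * hPrev (4 ℕ.+ k) + β * hPrev (3 ℕ.+ k) + γ * x)
      + (s * b + t * a) * (a * hPrev (3 ℕ.+ k) + β * x + γ * y)
      + t * b * (a * x + β * y + γ * z)
      ≈⟨ +-cong (+-cong (*-congˡ (+-congʳ (+-cong (*-congˡ (recurrence-twice hPrev-satisfiesRecurrence k))
                                                  (*-congˡ (hPrev-satisfiesRecurrence k)))))
                        (*-congˡ (+-congʳ (+-congʳ (*-congˡ (hPrev-satisfiesRecurrence k))))))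
                refl ⟩
    c′ * (a * (r * (r * x + s * y + t * z) + s * x + t * y) + β * (r * x + s * y + t * z) + γ * x)
      + (s * b + t * a) * (a * (r * x + s * y + t * z) + β * x + γ * y)
      + t * b * (a * x + β * y + γ * z)
      ≈⟨ solve 9 (λ r s t a b c′ x y z →
           c′ :* (a :* (r :* (r :* x :+ s :* y :+ t :* z) :+ s :* x :+ t :* y)
                  :+ (b :- r :* a) :* (r :* x :+ s :* y :+ t :* z) :+ (c′ :- r :* b :- s :* a) :* x)
             :+ (s :* b :+ t :* a) :* (a :* (r :* x :+ s :* y :+ t :* z) :+ (b :- r :* a) :* x
                                        :+ (c′ :- r :* b :- s :* a) :* y)
             :+ t :* b :* (a :* x :+ (b :- r :* a) :* y :+ (c′ :- r :* b :- s :* a) :* z)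
           := (c′ :* c′ :+ s :* (b :* b) :+ con (2 , 0) :* t :* a :* b) :* x
             :+ (b :* b :* (t :- r :* s) :+ con (2 , 0) :* t :* a :* c′ :+ con (2 , 0) :* s :* b :* c′
                 :- con (2 , 0) :* r :* t :* a :* b) :* y
             :+ t :* (t :* (a :* a) :- r :* (b :* b) :+ con (2 , 0) :* b :* c′) :* z)
           refl r s t a b c′ x y z ⟩
    (c′ * c′ + s * (b * b) + two * t * a * b) * x
      + (b * b * (t - r * s) + two * t * a * c′ + two * s * b * c′ - two * r * t * a * b) * y
      + t * (t * (a * a) - r * (b * b) + two * b * c′) * z ∎
    where
    X : ℕ → Carrier
    X = H r s t a b c′
    β γ x y z : Carrier
    β = b - r * a
    γ = c′ - r * b - s * a
    x = hPrev (2 ℕ.+ k)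
    y = hPrev (1 ℕ.+ k)
    z = hPrev k

  hOddExpansion≈doubledIndex : ∀ a b c′ n → let X = H r s t a b c′; m = n ℕ.+ n in
    (c′ * c′ + s * (b * b) + two * t * a * b) * h r s t (1 ℕ.+ m)
      + (b * b * (t - r * s) + two * t * a * c′ + two * s * b * c′ - two * r * t * a * b) * h r s t m
      + t * (t * (a * a) - r * (b * b) + two * b * c′) * hOdd r s t n
    ≈ c′ * X (2 ℕ.+ m) + (s * b + t * a) * X (1 ℕ.+ m) + t * b * X m
  hOddExpansion≈doubledIndex a b c′ n =
    trans (+-congˡ (*-congˡ (hOdd≈hPrev n))) (sym (doubledIndex≈hPrev-expansion a b c′ (n ℕ.+ n)))

corollary3p5 : {ℓc ℓ : Level} (R : CommutativeRing ℓc ℓ) →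
  let open CommutativeRing R
      open Seqs R
      dbl = λ (n : ℕ) → n Data.Nat.+ n
  in (r s t a b c : Carrier) → ¬ (t ≈ 0#) → (n : ℕ) →
    let Hn = H r s t a b c
        hn = h r s t
        lhs = Hn (2 Data.Nat.+ n) * Hn (2 Data.Nat.+ n)
              + s * (Hn (1 Data.Nat.+ n) * Hn (1 Data.Nat.+ n))
              + two * t * Hn n * Hn (1 Data.Nat.+ n)
        mid = (c * c + s * (b * b) + two * t * a * b) * hn (1 Data.Nat.+ dbl n)
              + (b * b * (t - r * s) + two * t * a * c + two * s * b * c - two * r * t * a * b) * hn (dbl n)
              + t * (t * (a * a) - r * (b * b) + two * b * c) * hOdd r s t n
        rhs = c * Hn (2 Data.Nat.+ dbl n) + (s * b + t * a) * Hn (1 Data.Nat.+ dbl n) + t * b * Hn (dbl n)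
    in (lhs ≈ mid) × (mid ≈ rhs)
-- The paper needs t ≠ 0 only to obtain h₋₁ = 0 from the backward recurrence;
-- here h₋₁ = 0 is built into hOdd.
corollary3p5 R r s t a b c _ n =
    trans (squares≈doubledIndex (H-satisfiesRecurrence a b c) n) (sym (hOddExpansion≈doubledIndex a b c n))
  , hOddExpansion≈doubledIndex a b c n
  where
  open CommutativeRing R using (trans; sym)
  open ThirdOrderRecurrence R r s t
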